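{- If a sequent $A \vdash_{\mathsf{L}} B$ is derivable in $\mathtt{SkMBiCA}$, then it is valid in every $\mathtt{SkMBiCA}$ model, i.e. $v(A) \subseteq v(B)$ for every $\mathtt{SkMBiCA}$ model $\langle W,\leq,\mathbb{I},\mathbb{L},\mathbb{R},v\rangle$.
   Context: Formulae are generated by $A,B ::= X \mid \mathsf{I} \mid A \otimes^{\mathsf{L}} B \mid A \multimap^{\mathsf{L}} B \mid A \otimes^{\mathsf{R}} B \mid A \multimap^{\mathsf{R}} B$, with $X$ ranging over a set of atoms. $\mathtt{SkMBiCA}$ has sequents $A \vdash_{\mathsf{L}} B$ generated by: (id) $A\vdash_{\mathsf{L}} A$; (comp) from $A \vdash_{\mathsf{L}} B$ and $B \vdash_{\mathsf{L}} C$ infer $A \vdash_{\mathsf{L}} C$; ($\otimes^{\mathsf{L}}$) from $A\vdash_{\mathsf{L}} C$, $B \vdash_{\mathsf{L}} D$ infer $A\otimes^{\mathsf{L}} B \vdash_{\mathsf{L}} C \otimes^{\mathsf{L}} D$; ($\multimap^{\mathsf{L}}$) from $C \vdash_{\mathsf{L}} A$, $B \vdash_{\mathsf{L}} D$ infer $A\multimap^{\mathsf{L}} B \vdash_{\mathsf{L}} C\multimap^{\mathsf{L}} D$; ($\multimap^{\mathsf{R}}$) from $C \vdash_{\mathsf{L}} A$, $B \vdash_{\mathsf{L}} D$ infer $A\multimap^{\mathsf{R}} B \vdash_{\mathsf{L}} C\multimap^{\mathsf{R}} D$; axioms ($\lambda$) $\mathsf{I}\otimes^{\mathsf{L}} A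 \vdash_{\mathsf{L}} A$, ($\rho$) $A \vdash_{\mathsf{L}} A \otimes^{\mathsf{L}} \mathsf{I}$, ($\alpha$) $(A\otimes^{\mathsf{L}} B)\otimes^{\mathsf{L}} C \vdash_{\mathsf{L}} A \otimes^{\mathsf{L}}(B\otimes^{\mathsf{L}} C)$, ($\gamma$) $A \otimes^{\mathsf{L}} B \vdash_{\mathsf{L}} B \otimes^{\mathsf{R}} A$, ($\gamma^{ -1}$) $A \otimes^{\mathsf{R}} B \vdash_{\mathsf{L}} B \otimes^{\mathsf{L}} A$; bidirectional rules ($\pi$) $A \vdash_{\mathsf{L}} B \multimap^{\mathsf{L}} C$ iff $A \otimes^{\mathsf{L}} B \vdash_{\mathsf{L}} C$, ($\pi^{\mathsf{R}}$) $A \vdash_{\mathsf{L}} B \multimap^{\mathsf{R}} C$ iff $A \otimes^{\mathsf{R}} B \vdash_{\mathsf{L}} C$. A ternary frame is $\langle W,\leq,\mathbb{I},\mathbb{L}\rangle$ with $W$ a set, $\leq$ a preorder on $W$, $\mathbb{I}\subseteq W$ downward closed, and $\mathbb{L}\subseteq W^3$ upward closed in its first two arguments and downward closed in its third (if $\mathbb{L}abc$, $a\le a'$, $b\le b'$, $c'\le c$ then $\mathbb{L}a'b'c'$). A $\mathtt{SkMBiCA}$ frame is $\langle W,\leq,\mathbb{I},\mathbb{L},\mathbb{R}\rangle$ where $\mathbb{L},\mathbb{R}$ are both such ternary relations, satisfying: ($\mathbb{LR}$-reverse) $\mathbb{L}abc \iff \mathbb{R}bac$ for all $a,b,c$; (LSA)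 for all $a,b,c,d,x$, if $\mathbb{L}abx$ and $\mathbb{L}xcd$ then there is $y$ with $\mathbb{L}bcy$ and $\mathbb{L}ayd$; (LSLU) for all $a,b\in W$, $e\in\mathbb{I}$, $\mathbb{L}eab$ implies $b\le a$; (LSRU) for all $a\in W$ there is $e\in\mathbb{I}$ with $\mathbb{L}aea$. A valuation is a function $v$ from formulae to downward closed subsets of $W$ with $v(\mathsf{I})=\mathbb{I}$, $v(A\otimes^{\mathsf{L}} B) = \{c : \exists a\in v(A), b\in v(B), \mathbb{L}abc\}$, $v(A\multimap^{\mathsf{L}} B)=\{c : \forall a\in v(A), b\in W, \mathbb{L}cab \Rightarrow b\in v(B)\}$, and the same two clauses for $\otimes^{\mathsf{R}},\multimap^{\mathsf{R}}$ with $\mathbb{R}$ in place of $\mathbb{L}$. A $\mathtt{SkMBiCA}$ model is a $\mathtt{SkMBiCA}$ frame together with a valuation. -}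

module Defs where

open import Level using (Level; _⊔_; suc)
open import Data.Product using (Σ; _×_; _,_; ∃)
open import Function.Bundles using (_⇔_)

data Fml (At : Set) : Set where
  atom : At → Fml At
  I    : Fml At
  _⊗L_ : Fml At → Fml At → Fml At
  _⊸L_ : Fml At → Fml At → Fml At
  _⊗R_ : Fml At → Fml At → Fml At
  _⊸R_ : Fml At → Fml At → Fml At

infixr 6 _⊗L_ _⊗R_
infixr 5 _⊸L_ _⊸R_
infix 3 _⊢L_

data _⊢L_ {At : Set} : Fml At → Fml At → Set where
  id    : ∀ {A} → A ⊢L A
  comp  : ∀ {A B C} → A ⊢L B → B ⊢L C → A ⊢L C
  ⊗L-r  : ∀ {A B C D} → A ⊢L C → B ⊢L D → A ⊗L B ⊢L C ⊗L D
  ⊸L-r  : ∀ {A B C D} → C ⊢L A → B ⊢L D → A ⊸L B ⊢L C ⊸L D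
  ⊸R-r  : ∀ {A B C D} → C ⊢L A → B ⊢L D → A ⊸R B ⊢L C ⊸R D
  λ-ax  : ∀ {A} → I ⊗L A ⊢L A
  ρ-ax  : ∀ {A} → A ⊢L A ⊗L I
  α-ax  : ∀ {A B C} → (A ⊗L B) ⊗L C ⊢L A ⊗L (B ⊗L C)
  γ-ax  : ∀ {A B} → A ⊗L B ⊢L B ⊗R A
  γ⁻¹-ax : ∀ {A B} → A ⊗R B ⊢L B ⊗L A
  π     : ∀ {A B C} → A ⊗L B ⊢L C → A ⊢L B ⊸L C
  π⁻¹   : ∀ {A B C} → A ⊢L B ⊸L C → A ⊗L B ⊢L C
  πR    : ∀ {A B C} → A ⊗R B ⊢L C → A ⊢L B ⊸R C
  πR⁻¹  : ∀ {A B C} → A ⊢L B ⊸R C → A ⊗R B ⊢L C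

Subset : Set → Set₁
Subset W = W → Set

_⊆_ : {W : Set} → Subset W → Subset W → Set
P ⊆ Q = ∀ {x} → P x → Q x

TernaryMono : {W : Set} → (W → W → Set) → (W → W → W → Set) → Set
TernaryMono {W} _≤_ T =
  ∀ {a b c a' b' c' : W} → T a b c → a ≤ a' → b ≤ b' → c' ≤ c → T a' b' c'

DownClosed : {W : Set} → (W → W → Set) → Subset W → Set
DownClosed {W} _≤_ P = ∀ {a b : W} → P a → b ≤ a → P b

record SkMBiCAFrame : Set₁ where
  field
    W     : Set
    _≤_   : W → W → Set
    ≤-refl  : ∀ {a} → a ≤ a
    ≤-trans : ∀ {a b c} → a ≤ b → b ≤ c → a ≤ c
    𝕀     : Subset W
    𝕀-down : DownClosed _≤_ 𝕀
    𝕃     : W → W → W → Set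
    ℝ     : W → W → W → Set
    𝕃-mono : TernaryMono _≤_ 𝕃
    ℝ-mono : TernaryMono _≤_ ℝ
    LR-reverse : ∀ a b c → 𝕃 a b c ⇔ ℝ b a c
    LSA  : ∀ a b c d x → 𝕃 a b x → 𝕃 x c d → ∃ λ y → 𝕃 b c y × 𝕃 a y d
    LSLU : ∀ a b e → 𝕀 e → 𝕃 e a b → b ≤ a
    LSRU : ∀ a → ∃ λ e → 𝕀 e × 𝕃 a e a

_≐_ : {W : Set} → Subset W → Subset W → Set
P ≐ Q = (P ⊆ Q) × (Q ⊆ P)

module _ (F : SkMBiCAFrame) where
  open SkMBiCAFrame F

  Tensor : (W → W → W → Set) → Subset W → Subset W → Subset W
  Tensor T P Q c = ∃ λ a → ∃ λ b → P a × Q b × T a b c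

  Implies : (W → W → W → Set) → Subset W → Subset W → Subset W
  Implies T P Q c = ∀ a b → P a → T c a b → Q b

  record Valuation (At : Set) : Set₁ where
    field
      v : Fml At → Subset W
      v-down : ∀ A → DownClosed _≤_ (v A)
      v-I  : v I ≐ 𝕀
      v-⊗L : ∀ A B → v (A ⊗L B) ≐ Tensor 𝕃 (v A) (v B)
      v-⊸L : ∀ A B → v (A ⊸L B) ≐ Implies 𝕃 (v A) (v B)
      v-⊗R : ∀ A B → v (A ⊗R B) ≐ Tensor ℝ (v A) (v B)
      v-⊸R : ∀ A B → v (A ⊸R B) ≐ Implies ℝ (v A) (v B)

{-# OPTIONS --safe #-}
module Submission where

open import Defs
open import Data.Product using (_,_; proj₁; proj₂)
open import Function.Bundles using (Equivalence)
open import Function using (_∘_)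
import Function

-- Every rule of SkMBiCA is an inclusion between the frame operations Tensor
-- and Implies: both are monotone, Tensor T is residuated by Implies T for any
-- ternary relation T, and each frame condition validates one axiom (LSLU: λ,
-- LSRU: ρ, LSA: α, LR-reverse: γ and γ⁻¹).

module FrameInclusions (F : SkMBiCAFrame) where
  open SkMBiCAFrame F

  Tensor-mono : ∀ T {P P′ Q Q′} → P ⊆ P′ → Q ⊆ Q′ →
                Tensor F T P Q ⊆ Tensor F T P′ Q′
  Tensor-mono _ P⊆P′ Q⊆Q′ (a , b , Pa , Qb , Tabc) = a , b , P⊆P′ Pa , Q⊆Q′ Qb , Tabc

  Implies-mono : ∀ T {P P′ Q Q′} → P′ ⊆ P → Q ⊆ Q′ →
                 Implies F T P Q ⊆ Implies F T P′ Q′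
  Implies-mono _ P′⊆P Q⊆Q′ imp a b P′a Tcab = Q⊆Q′ (imp a b (P′⊆P P′a) Tcab)

  Tensor⊆⇒⊆Implies : ∀ T {P Q R} → Tensor F T P Q ⊆ R → P ⊆ Implies F T Q R
  Tensor⊆⇒⊆Implies _ PQ⊆R {c} Pc a b Qa Tcab = PQ⊆R (c , a , Pc , Qa , Tcab)

  ⊆Implies⇒Tensor⊆ : ∀ T {P Q R} → P ⊆ Implies F T Q R → Tensor F T P Q ⊆ R
  ⊆Implies⇒Tensor⊆ _ P⊆Q⊸R (a , b , Pa , Qb , Tabc) = P⊆Q⊸R Pa b _ Qb Tabc

  𝕃-unitˡ : ∀ {P} → DownClosed _≤_ P → Tensor F 𝕃 𝕀 P ⊆ P
  𝕃-unitˡ P-down {b} (e , a , 𝕀e , Pa , 𝕃eab) = P-down Pa (LSLU a b e 𝕀e 𝕃eab)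

  𝕃-unitʳ : ∀ {P} → P ⊆ Tensor F 𝕃 P 𝕀
  𝕃-unitʳ {x = a} Pa with LSRU a
  ... | e , 𝕀e , 𝕃aea = a , e , Pa , 𝕀e , 𝕃aea

  𝕃-assoc : ∀ {P Q R} → Tensor F 𝕃 (Tensor F 𝕃 P Q) R ⊆ Tensor F 𝕃 P (Tensor F 𝕃 Q R)
  𝕃-assoc {x = d} (x , c , (a , b , Pa , Qb , 𝕃abx) , Rc , 𝕃xcd)
    with LSA a b c d x 𝕃abx 𝕃xcd
  ... | y , 𝕃bcy , 𝕃ayd = a , y , Pa , (b , c , Qb , Rc , 𝕃bcy) , 𝕃ayd

  𝕃⊆ℝ-swap : ∀ {P Q} → Tensor F 𝕃 P Q ⊆ Tensor F ℝ Q P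
  𝕃⊆ℝ-swap {x = c} (a , b , Pa , Qb , 𝕃abc) =
    b , a , Qb , Pa , Equivalence.to (LR-reverse a b c) 𝕃abc

  ℝ⊆𝕃-swap : ∀ {P Q} → Tensor F ℝ P Q ⊆ Tensor F 𝕃 Q P
  ℝ⊆𝕃-swap {x = c} (a , b , Pa , Qb , ℝabc) =
    b , a , Qb , Pa , Equivalence.from (LR-reverse b a c) ℝabc

module Soundness (F : SkMBiCAFrame) {At : Set} (val : Valuation F At) where
  open SkMBiCAFrame F
  open Valuation val
  open FrameInclusions F

  sound : ∀ {A B : Fml At} → A ⊢L B → v A ⊆ v B
  sound id           = Function.id
  sound (comp p q)   = sound q ∘ sound p
  sound (⊗L-r p q)   = proj₂ (v-⊗L _ _) ∘ Tensor-mono 𝕃 (sound p) (sound q) ∘ proj₁ (v-⊗L _ _)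
  sound (⊸L-r p q)   = proj₂ (v-⊸L _ _) ∘ Implies-mono 𝕃 (sound p) (sound q) ∘ proj₁ (v-⊸L _ _)
  sound (⊸R-r p q)   = proj₂ (v-⊸R _ _) ∘ Implies-mono ℝ (sound p) (sound q) ∘ proj₁ (v-⊸R _ _)
  sound (λ-ax {A})   = 𝕃-unitˡ (v-down A) ∘ Tensor-mono 𝕃 (proj₁ v-I) Function.id ∘ proj₁ (v-⊗L _ _)
  sound ρ-ax         = proj₂ (v-⊗L _ _) ∘ Tensor-mono 𝕃 Function.id (proj₂ v-I) ∘ 𝕃-unitʳ
  sound α-ax         = proj₂ (v-⊗L _ _) ∘ Tensor-mono 𝕃 Function.id (proj₂ (v-⊗L _ _))
                     ∘ 𝕃-assoc
                     ∘ Tensor-mono 𝕃 (proj₁ (v-⊗L _ _)) Function.id ∘ proj₁ (v-⊗L _ _)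
  sound γ-ax         = proj₂ (v-⊗R _ _) ∘ 𝕃⊆ℝ-swap ∘ proj₁ (v-⊗L _ _)
  sound γ⁻¹-ax       = proj₂ (v-⊗L _ _) ∘ ℝ⊆𝕃-swap ∘ proj₁ (v-⊗R _ _)
  sound (π p)        = proj₂ (v-⊸L _ _) ∘ Tensor⊆⇒⊆Implies 𝕃 (sound p ∘ proj₂ (v-⊗L _ _))
  sound (π⁻¹ p)      = ⊆Implies⇒Tensor⊆ 𝕃 (proj₁ (v-⊸L _ _) ∘ sound p) ∘ proj₁ (v-⊗L _ _)
  sound (πR p)       = proj₂ (v-⊸R _ _) ∘ Tensor⊆⇒⊆Implies ℝ (sound p ∘ proj₂ (v-⊗R _ _))
  sound (πR⁻¹ p)     = ⊆Implies⇒Tensor⊆ ℝ (proj₁ (v-⊸R _ _) ∘ sound p) ∘ proj₁ (v-⊗R _ _)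

mainTheorem7 : {At : Set} {A B : Fml At} → A ⊢L B →
    (F : SkMBiCAFrame) (val : Valuation F At) →
    Valuation.v val A ⊆ Valuation.v val B
mainTheorem7 A⊢B F val = Soundness.sound F val A⊢B
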